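{- Let $n,k$ be natural numbers with $k<n-k$, let $X=\{1,\ldots,n\}$, and let $L_{k,n}=(V,E)$ be the graph with $V=[X]^{k}\cup[X]^{n-k}$ and $E=\{AB : A\in[X]^{k},\ B\in[X]^{n-k},\ A\subseteq B\}$. Define $d\colon V\times V\to\mathbb{N}$ by, for $A,B\in V$ with $i=|A\cap B|$, $$d(A,B)=\begin{cases} 2\left\lceil \frac{k-i}{n-2k}\right\rceil+1, & \text{if } |A|\neq|B|,\\ 2\left\lceil \frac{|A|-i}{n-2k}\right\rceil, & \text{if } |A|=|B|.\end{cases}$$ Then for all $A,B,C\in V$: $d(A,B)=0\iff A=B$; $d(A,B)=d(B,A)$; $d(A,B)+d(B,C)\geq d(A,C)$; and $d(A,B)=1\iff AB\in E$.
   Context: $[X]^m$ denotes the set of all $m$-element subsets of $X$. -}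

module Defs where

open import Data.Nat using (ℕ; zero; suc; _+_; _*_; _∸_; _<_; _≤_; NonZero; z≤n; s≤s; >-nonZero)
open import Data.Nat.DivMod using (_/_)
open import Data.Nat.Properties using (_≟_; m<n⇒0<n∸m)
open import Data.Fin.Subset using (Subset; ∣_∣; _∩_; _⊆_)
open import Data.Product using (Σ; _×_; proj₁)
open import Data.Sum using (_⊎_)
open import Relation.Nullary using (yes; no)
open import Relation.Binary.PropositionalEquality using (_≡_)

⌈_/_⌉ : (a b : ℕ) → .{{NonZero b}} → ℕ
⌈ a / b ⌉ = (a + (b ∸ 1)) / b

-- X = {1,…,n} is represented by Fin n; subsets of X are Subset n.
-- The vertex set V = [X]^k ∪ [X]^(n-k) of L_{k,n}.
Vertex : (n k : ℕ) → Set
Vertex n k = Σ (Subset n) (λ A → (∣ A ∣ ≡ k) ⊎ (∣ A ∣ ≡ n ∸ k))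

-- Edge set: AB ∈ E iff one of them is a k-set contained in the other, which is an (n-k)-set.
-- (Edges are unordered, so both orientations are allowed.)
Edge : (n k : ℕ) → Vertex n k → Vertex n k → Set
Edge n k A B =
    (∣ proj₁ A ∣ ≡ k × ∣ proj₁ B ∣ ≡ n ∸ k × proj₁ A ⊆ proj₁ B)
  ⊎ (∣ proj₁ B ∣ ≡ k × ∣ proj₁ A ∣ ≡ n ∸ k × proj₁ B ⊆ proj₁ A)

n∸2k-nonZero : (n k : ℕ) → k < n ∸ k → NonZero (n ∸ (k + k))
n∸2k-nonZero n k k<n∸k = >-nonZero (subst (0 <_) eq (m<n⇒0<n∸m k<n∸k))
  where
  open import Relation.Binary.PropositionalEquality using (subst)
  open import Data.Nat.Properties using (∸-+-assoc)
  eq : n ∸ k ∸ k ≡ n ∸ (k + k)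
  eq = ∸-+-assoc n k k

d : (n k : ℕ) → k < n ∸ k → Vertex n k → Vertex n k → ℕ
d n k h A B with ∣ proj₁ A ∣ ≟ ∣ proj₁ B ∣
... | no  _ = 2 * ⌈ (k ∸ i) / (n ∸ (k + k)) ⌉ {{n∸2k-nonZero n k h}} + 1
  where i = ∣ proj₁ A ∩ proj₁ B ∣
... | yes _ = 2 * ⌈ (∣ proj₁ A ∣ ∸ i) / (n ∸ (k + k)) ⌉ {{n∸2k-nonZero n k h}}
  where i = ∣ proj₁ A ∩ proj₁ B ∣

module Submission where

open import Defs
open import Data.Nat using (ℕ; _+_; _<_; _≥_; _∸_)
open import Data.Product using (_×_; proj₁)
open import Function.Bundles using (_⇔_)
open import Relation.Binary.PropositionalEquality using (_≡_)

open import Data.Nat using (suc; _*_; _≤_; NonZero; z≤n; s≤s)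
open import Data.Nat.Properties
open import Data.Nat.DivMod using (_/_; _%_; m≡m%n+[m/n]*n; m%n<n; m<n*o⇒m/o<n)
open import Data.Nat.Solver using (module +-*-Solver)
open +-*-Solver using (solve; _:+_; _:*_; _:=_; con)
open import Data.Fin.Subset using (Subset; ∣_∣; _∩_; _⊆_; _∈_; inside; outside)
open import Data.Fin.Subset.Properties
  using (∣p∩q∣≤∣p∣; ∣p∩q∣≤∣q∣; ∩-comm; p∩q⊆p; p∩q⊆q; x∈p∩q⁺; ⊆-antisym)
open import Data.Vec using ([]; _∷_)
open import Data.Product using (_,_)
open import Data.Sum using (inj₁; inj₂; swap)
open import Data.Empty using (⊥-elim)
open import Relation.Nullary using (yes; no)
open import Relation.Binary.PropositionalEquality
  using (_≢_; refl; sym; trans; cong; cong₂; subst; subst₂; module ≡-Reasoning)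
open import Function.Bundles using (mk⇔; Equivalence)
open import Function.Construct.Composition using (_⇔-∘_)

-- Write m = n - 2k > 0.  Every vertex lies on one of two layers, the k-sets and the
-- (n-k)-sets = (k+m)-sets.  Call two vertices' "bound" the smaller of their sizes and their
-- "defect" the bound minus the size of their intersection.  Unfolding the definition,
--     d(A,B) = 2 ⌈defect(A,B) / m⌉ + gap(A,B),
-- where gap is 0 on one layer and 1 across layers (`d-formula`).
--   * The triangle inequality comes from three independent facts: defects are subadditive up
--     to m·detour (detour = 1 exactly when A,C lie on one layer and B on the other), which
--     rests on the counting inequality |A∩B| + |B∩C| ≤ |B| + |A∩C|; ceiling division turns this
--     into subadditivity of ⌈·/m⌉ up to +detour; and 2·detour + gap(A,C) = gap(A,B) + gap(B,C).
--   * d(A,B) = 0 and d(A,B) = 1 are decided by the parity of d (i.e. the layers) and by whether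
--     the defect vanishes, which for a smaller-or-equal set A means A ⊆ B (resp. A = B).

-- Elements counted in both A∩B and B∩C lie in A∩C, so the two overlaps
-- with B can exceed |B| by at most |A∩C|.
overlap-bound : ∀ {n} (A B C : Subset n) → ∣ A ∩ B ∣ + ∣ B ∩ C ∣ ≤ ∣ B ∣ + ∣ A ∩ C ∣
overlap-bound [] [] [] = z≤n
overlap-bound (inside ∷ A) (inside ∷ B) (inside ∷ C)
  rewrite +-suc ∣ A ∩ B ∣ ∣ B ∩ C ∣ | +-suc ∣ B ∣ ∣ A ∩ C ∣ = s≤s (s≤s (overlap-bound A B C))
overlap-bound (inside ∷ A) (inside ∷ B) (outside ∷ C) = s≤s (overlap-bound A B C)
overlap-bound (inside ∷ A) (outside ∷ B) (inside ∷ C)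
  rewrite +-suc ∣ B ∣ ∣ A ∩ C ∣ = m≤n⇒m≤1+n (overlap-bound A B C)
overlap-bound (inside ∷ A) (outside ∷ B) (outside ∷ C) = overlap-bound A B C
overlap-bound (outside ∷ A) (inside ∷ B) (inside ∷ C)
  rewrite +-suc ∣ A ∩ B ∣ ∣ B ∩ C ∣ = s≤s (overlap-bound A B C)
overlap-bound (outside ∷ A) (inside ∷ B) (outside ∷ C) = m≤n⇒m≤1+n (overlap-bound A B C)
overlap-bound (outside ∷ A) (outside ∷ B) (inside ∷ C) = overlap-bound A B C
overlap-bound (outside ∷ A) (outside ∷ B) (outside ∷ C) = overlap-bound A B C

full-overlap : ∀ {n} (A B : Subset n) → ∣ A ∣ ≤ ∣ A ∩ B ∣ → A ∩ B ≡ A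
full-overlap [] [] _ = refl
full-overlap (inside ∷ A) (inside ∷ B) (s≤s le) = cong (inside ∷_) (full-overlap A B le)
full-overlap (inside ∷ A) (outside ∷ B) le = ⊥-elim (1+n≰n (≤-trans le (∣p∩q∣≤∣p∣ A B)))
full-overlap (outside ∷ A) (_ ∷ B) le = cong (outside ∷_) (full-overlap A B le)

⊆⇔full-overlap : ∀ {n} (A B : Subset n) → (∣ A ∣ ≤ ∣ A ∩ B ∣) ⇔ (A ⊆ B)
⊆⇔full-overlap A B = mk⇔ to from
  where
  to : ∣ A ∣ ≤ ∣ A ∩ B ∣ → A ⊆ B
  to le x∈A = p∩q⊆q A B (subst (_ ∈_) (sym (full-overlap A B le)) x∈A)
  from : A ⊆ B → ∣ A ∣ ≤ ∣ A ∩ B ∣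
  from A⊆B = ≤-reflexive (cong ∣_∣ (⊆-antisym (λ x∈A → x∈p∩q⁺ (x∈A , A⊆B x∈A)) (p∩q⊆p A B)))

≡⇔full-overlap : ∀ {n} (A B : Subset n) → ∣ A ∣ ≡ ∣ B ∣ → (∣ A ∣ ≤ ∣ A ∩ B ∣) ⇔ (A ≡ B)
≡⇔full-overlap A B |A|≡|B| = mk⇔ to from
  where
  to : ∣ A ∣ ≤ ∣ A ∩ B ∣ → A ≡ B
  to le = ⊆-antisym (Equivalence.to (⊆⇔full-overlap A B) le)
    (Equivalence.to (⊆⇔full-overlap B A)
      (subst₂ _≤_ |A|≡|B| (cong ∣_∣ (∩-comm A B)) le))
  from : A ≡ B → ∣ A ∣ ≤ ∣ A ∩ B ∣
  from refl = Equivalence.from (⊆⇔full-overlap A A) (λ x∈A → x∈A)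

⌈⌉-covers : ∀ m .{{_ : NonZero m}} x → x ≤ ⌈ x / m ⌉ * m
⌈⌉-covers (suc j) x = +-cancelʳ-≤ j x (⌈ x / suc j ⌉ * suc j) (begin
  x + j                                    ≡⟨ m≡m%n+[m/n]*n (x + j) (suc j) ⟩
  (x + j) % suc j + ⌈ x / suc j ⌉ * suc j   ≤⟨ +-monoˡ-≤ _ (≤-pred (m%n<n (x + j) (suc j))) ⟩
  j + ⌈ x / suc j ⌉ * suc j                 ≡⟨ +-comm j _ ⟩
  ⌈ x / suc j ⌉ * suc j + j                 ∎)
  where open ≤-Reasoning

⌈⌉-least : ∀ m .{{_ : NonZero m}} x t → x ≤ t * m → ⌈ x / m ⌉ ≤ t
⌈⌉-least (suc j) x t x≤tm = ≤-pred (m<n*o⇒m/o<n {x + j} {suc t} {suc j}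
  (s≤s (≤-trans (+-monoˡ-≤ j x≤tm) (≤-reflexive (+-comm (t * suc j) j)))))

⌈⌉≡0⇔ : ∀ m .{{_ : NonZero m}} x → (⌈ x / m ⌉ ≡ 0) ⇔ (x ≡ 0)
⌈⌉≡0⇔ m x = mk⇔
  (λ c≡0 → n≤0⇒n≡0 (subst (λ t → x ≤ t * m) c≡0 (⌈⌉-covers m x)))
  (λ { refl → n≤0⇒n≡0 (⌈⌉-least m 0 0 z≤n) })

⌈⌉-subadditive : ∀ m .{{_ : NonZero m}} x y z j → x ≤ y + z + j * m →
                 ⌈ x / m ⌉ ≤ ⌈ y / m ⌉ + ⌈ z / m ⌉ + j
⌈⌉-subadditive m x y z j x≤ = ⌈⌉-least m x (Y + Z + j) (begin
  x                       ≤⟨ x≤ ⟩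
  y + z + j * m           ≤⟨ +-monoˡ-≤ (j * m) (+-mono-≤ (⌈⌉-covers m y) (⌈⌉-covers m z)) ⟩
  Y * m + Z * m + j * m   ≡⟨ cong (_+ j * m) (*-distribʳ-+ m Y Z) ⟨
  (Y + Z) * m + j * m     ≡⟨ *-distribʳ-+ m (Y + Z) j ⟨
  (Y + Z + j) * m         ∎)
  where
  open ≤-Reasoning
  Y = ⌈ y / m ⌉
  Z = ⌈ z / m ⌉

-- Triangle inequality for "defects" t ∸ p (how far an overlap p falls short of its
-- bound t): if two overlaps p, q jointly fit into b + r and the bound s of the third
-- overlap r satisfies s + b ≤ t + u + e, then s ∸ r ≤ (t ∸ p) + (u ∸ q) + e.
defect-triangle : ∀ {p q r s t u b e} → p ≤ t → q ≤ u → p + q ≤ b + r → s + b ≤ t + u + e →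
                  s ∸ r ≤ (t ∸ p) + (u ∸ q) + e
defect-triangle {p} {q} {r} {s} {t} {u} {b} {e} p≤t q≤u overlaps bounds =
  m≤n+o⇒m∸n≤o s r (+-cancelˡ-≤ (p + q) s (r + (t′ + u′ + e)) (begin
    p + q + s                   ≤⟨ +-monoˡ-≤ s overlaps ⟩
    b + r + s                   ≡⟨ solve 3 (λ b r s → b :+ r :+ s := s :+ b :+ r) refl b r s ⟩
    s + b + r                   ≤⟨ +-monoˡ-≤ r bounds ⟩
    t + u + e + r               ≡⟨ cong₂ (λ t u → t + u + e + r) (sym (m+[n∸m]≡n p≤t)) (sym (m+[n∸m]≡n q≤u)) ⟩
    p + t′ + (q + u′) + e + r   ≡⟨ solve 6 (λ p t′ q u′ e r → p :+ t′ :+ (q :+ u′) :+ e :+ r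
                                                 := p :+ q :+ (r :+ (t′ :+ u′ :+ e))) refl p t′ q u′ e r ⟩
    p + q + (r + (t′ + u′ + e)) ∎))
  where
  open ≤-Reasoning
  t′ = t ∸ p
  u′ = u ∸ q

double-plus-parity : ∀ {X Y Z j g g₁ g₂} → X ≤ Y + Z + j → 2 * j + g ≡ g₁ + g₂ →
                     2 * X + g ≤ (2 * Y + g₁) + (2 * Z + g₂)
double-plus-parity {X} {Y} {Z} {j} {g} {g₁} {g₂} X≤ parity = begin
  2 * X + g                     ≤⟨ +-monoˡ-≤ g (*-monoʳ-≤ 2 X≤) ⟩
  2 * (Y + Z + j) + g           ≡⟨ solve 4 (λ Y Z j g → con 2 :* (Y :+ Z :+ j) :+ g
                                            := con 2 :* Y :+ con 2 :* Z :+ (con 2 :* j :+ g)) refl Y Z j g ⟩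
  2 * Y + 2 * Z + (2 * j + g)   ≡⟨ cong (2 * Y + 2 * Z +_) parity ⟩
  2 * Y + 2 * Z + (g₁ + g₂)     ≡⟨ solve 4 (λ Y Z g₁ g₂ → con 2 :* Y :+ con 2 :* Z :+ (g₁ :+ g₂)
                                            := (con 2 :* Y :+ g₁) :+ (con 2 :* Z :+ g₂)) refl Y Z g₁ g₂ ⟩
  (2 * Y + g₁) + (2 * Z + g₂)   ∎
  where
  open ≤-Reasoning

even≡0⇔ : ∀ x → (2 * x + 0 ≡ 0) ⇔ (x ≡ 0)
even≡0⇔ x = mk⇔ (λ e → *-cancelˡ-≡ x 0 2 (trans (sym (+-identityʳ (2 * x))) e)) (λ { refl → refl })

odd≡1⇔ : ∀ x → (2 * x + 1 ≡ 1) ⇔ (x ≡ 0)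
odd≡1⇔ x = mk⇔ (λ e → *-cancelˡ-≡ x 0 2 (+-cancelʳ-≡ 1 (2 * x) 0 e)) (λ { refl → refl })

even≢1 : ∀ x → 2 * x + 0 ≢ 1
even≢1 x e = even≢odd x 0 (trans (sym (+-identityʳ (2 * x))) e)

odd≢0 : ∀ x → 2 * x + 1 ≢ 0
odd≢0 x = m+1+n≢0 (2 * x)

∸≡0⇔≤ : ∀ a b → (a ∸ b ≡ 0) ⇔ (a ≤ b)
∸≡0⇔≤ a b = mk⇔ m∸n≡0⇒m≤n m≤n⇒m∸n≡0

data Layer : Set where
  lower upper : Layer

-- 1 for a pair of vertices on different layers, 0 on the same layer: the parity of d.
gap : Layer → Layer → ℕ
gap lower lower = 0
gap lower upper = 1
gap upper lower = 1
gap upper upper = 0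

detour : Layer → Layer → Layer → ℕ
detour lower upper lower = 1
detour upper lower upper = 1
detour _     _     _     = 0

gap-sym : ∀ a b → gap a b ≡ gap b a
gap-sym lower lower = refl
gap-sym lower upper = refl
gap-sym upper lower = refl
gap-sym upper upper = refl

gap-triangle : ∀ a b c → 2 * detour a b c + gap a c ≡ gap a b + gap b c
gap-triangle lower lower lower = refl
gap-triangle lower lower upper = refl
gap-triangle lower upper lower = refl
gap-triangle lower upper upper = refl
gap-triangle upper lower lower = refl
gap-triangle upper lower upper = refl
gap-triangle upper upper lower = refl
gap-triangle upper upper upper = refl

module Distance (n k : ℕ) (h : k < n ∸ k) where

  m : ℕ
  m = n ∸ (k + k)

  instance
    m-nonZero : NonZero m
    m-nonZero = n∸2k-nonZero n k h

  ceil : ℕ → ℕ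
  ceil x = ⌈ x / m ⌉

  D : Vertex n k → Vertex n k → ℕ
  D = d n k h

  ι : Vertex n k → Vertex n k → ℕ
  ι A B = ∣ proj₁ A ∩ proj₁ B ∣

  ι-sym : ∀ A B → ι A B ≡ ι B A
  ι-sym A B = cong ∣_∣ (∩-comm (proj₁ A) (proj₁ B))

  k≢n∸k : k ≢ n ∸ k
  k≢n∸k = <⇒≢ h

  n∸k≡k+m : n ∸ k ≡ k + m
  n∸k≡k+m = trans (sym (m+[n∸m]≡n (<⇒≤ h))) (cong (k +_) (∸-+-assoc n k k))

  size : Layer → ℕ
  size lower = k
  size upper = k + m

  layer : Vertex n k → Layer
  layer (_ , inj₁ _) = lower
  layer (_ , inj₂ _) = upper

  ∣layer∣ : ∀ A → ∣ proj₁ A ∣ ≡ size (layer A)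
  ∣layer∣ (_ , inj₁ |A|≡k) = |A|≡k
  ∣layer∣ (_ , inj₂ |A|≡n∸k) = trans |A|≡n∸k n∸k≡k+m

  bound : Layer → Layer → ℕ
  bound upper upper = k + m
  bound _     _     = k

  bound-sym : ∀ a b → bound a b ≡ bound b a
  bound-sym lower lower = refl
  bound-sym lower upper = refl
  bound-sym upper lower = refl
  bound-sym upper upper = refl

  ι≤bound : ∀ A B → ι A B ≤ bound (layer A) (layer B)
  ι≤bound (A , inj₁ |A|≡k) (B , _) = subst (_ ≤_) |A|≡k (∣p∩q∣≤∣p∣ A B)
  ι≤bound (A , inj₂ _) (B , inj₁ |B|≡k) = subst (_ ≤_) |B|≡k (∣p∩q∣≤∣q∣ A B)
  ι≤bound A@(_ , inj₂ _) B@(_ , inj₂ _) = subst (ι A B ≤_) (∣layer∣ A) (∣p∩q∣≤∣p∣ (proj₁ A) (proj₁ B))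

  -- The bounds satisfy the defect hypothesis of `defect-triangle` with e = m·detour.
  bound-triangle : ∀ a b c → bound a c + size b ≡ bound a b + bound b c + detour a b c * m
  bound-triangle lower lower lower = sym (+-identityʳ (k + k))
  bound-triangle lower lower upper = sym (+-identityʳ (k + k))
  bound-triangle lower upper lower = solve 2 (λ k m → k :+ (k :+ m) := k :+ k :+ (m :+ con 0)) refl k m
  bound-triangle lower upper upper = sym (+-identityʳ (k + (k + m)))
  bound-triangle upper lower lower = sym (+-identityʳ (k + k))
  bound-triangle upper lower upper = solve 2 (λ k m → k :+ m :+ k := k :+ k :+ (m :+ con 0)) refl k m
  bound-triangle upper upper lower = solve 2 (λ k m → k :+ (k :+ m) := k :+ m :+ k :+ con 0) refl k m
  bound-triangle upper upper upper = sym (+-identityʳ (k + m + (k + m)))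

  d-same : ∀ A B → ∣ proj₁ A ∣ ≡ ∣ proj₁ B ∣ → D A B ≡ 2 * ceil (∣ proj₁ A ∣ ∸ ι A B)
  d-same A B |A|≡|B| with ∣ proj₁ A ∣ ≟ ∣ proj₁ B ∣
  ... | yes _ = refl
  ... | no |A|≢|B| = ⊥-elim (|A|≢|B| |A|≡|B|)

  d-across : ∀ A B → ∣ proj₁ A ∣ ≢ ∣ proj₁ B ∣ → D A B ≡ 2 * ceil (k ∸ ι A B) + 1
  d-across A B |A|≢|B| with ∣ proj₁ A ∣ ≟ ∣ proj₁ B ∣
  ... | yes |A|≡|B| = ⊥-elim (|A|≢|B| |A|≡|B|)
  ... | no _ = refl

  d-within : ∀ A B s → ∣ proj₁ A ∣ ≡ s → ∣ proj₁ B ∣ ≡ s → D A B ≡ 2 * ceil (s ∸ ι A B) + 0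
  d-within A B s |A|≡s |B|≡s = begin
    D A B                            ≡⟨ d-same A B (trans |A|≡s (sym |B|≡s)) ⟩
    2 * ceil (∣ proj₁ A ∣ ∸ ι A B)   ≡⟨ cong (λ t → 2 * ceil (t ∸ ι A B)) |A|≡s ⟩
    2 * ceil (s ∸ ι A B)             ≡⟨ +-identityʳ _ ⟨
    2 * ceil (s ∸ ι A B) + 0         ∎
    where open ≡-Reasoning

  sizes-differ : ∀ {a b} → a ≡ k → b ≡ n ∸ k → a ≢ b
  sizes-differ a≡k b≡n∸k a≡b = k≢n∸k (trans (sym a≡k) (trans a≡b b≡n∸k))

  defect : Vertex n k → Vertex n k → ℕ
  defect A B = bound (layer A) (layer B) ∸ ι A B

  d-formula : ∀ A B → D A B ≡ 2 * ceil (defect A B) + gap (layer A) (layer B)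
  d-formula A@(_ , inj₁ |A|≡k) B@(_ , inj₁ |B|≡k) = d-within A B k |A|≡k |B|≡k
  d-formula A@(_ , inj₂ _) B@(_ , inj₂ _) = d-within A B (k + m) (∣layer∣ A) (∣layer∣ B)
  d-formula A@(_ , inj₁ |A|≡k) B@(_ , inj₂ |B|≡n∸k) = d-across A B (sizes-differ |A|≡k |B|≡n∸k)
  d-formula A@(_ , inj₂ |A|≡n∸k) B@(_ , inj₁ |B|≡k) =
    d-across A B (λ |A|≡|B| → sizes-differ |B|≡k |A|≡n∸k (sym |A|≡|B|))

  -- Symmetry: every ingredient of `d-formula` is symmetric.
  d-sym : ∀ A B → D A B ≡ D B A
  d-sym A B = begin
    D A B                                  ≡⟨ d-formula A B ⟩
    2 * ceil (bound a b ∸ ι A B) + gap a b ≡⟨ cong₂ (λ s g → 2 * ceil s + g)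
                                                (cong₂ _∸_ (bound-sym a b) (ι-sym A B)) (gap-sym a b) ⟩
    2 * ceil (bound b a ∸ ι B A) + gap b a ≡⟨ d-formula B A ⟨
    D B A                                  ∎
    where
    open ≡-Reasoning
    a = layer A
    b = layer B

  defect-subadditive : ∀ A B C →
    defect A C ≤ defect A B + defect B C + detour (layer A) (layer B) (layer C) * m
  defect-subadditive A B C =
    defect-triangle {r = ι A C} {s = bound a c} {b = ∣ proj₁ B ∣} (ι≤bound A B) (ι≤bound B C)
    (overlap-bound (proj₁ A) (proj₁ B) (proj₁ C))
    (≤-reflexive (trans (cong (bound a c +_) (∣layer∣ B)) (bound-triangle a b c)))
    where
    a = layer A
    b = layer B
    c = layer C

  -- Triangle inequality: round the subadditivity of defects and add the parities.
  d-triangle : ∀ A B C → D A C ≤ D A B + D B C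
  d-triangle A B C = begin
    D A C                                                                 ≡⟨ d-formula A C ⟩
    2 * ceil (defect A C) + gap a c                                       ≤⟨ double-plus-parity
      {Y = ceil (defect A B)} {Z = ceil (defect B C)} {j = detour a b c} {g₁ = gap a b} {g₂ = gap b c}
      (⌈⌉-subadditive m (defect A C) (defect A B) (defect B C) (detour a b c) (defect-subadditive A B C))
      (gap-triangle a b c) ⟩
    (2 * ceil (defect A B) + gap a b) + (2 * ceil (defect B C) + gap b c) ≡⟨ cong₂ _+_ (d-formula A B) (d-formula B C) ⟨
    D A B + D B C                                                         ∎
    where
    open ≤-Reasoning
    a = layer A
    b = layer B
    c = layer C

  -- On one layer, d vanishes iff the defect does, i.e. iff the two sets coincide.
  d≡0-within : ∀ A B s → ∣ proj₁ A ∣ ≡ s → ∣ proj₁ B ∣ ≡ s → (D A B ≡ 0) ⇔ (proj₁ A ≡ proj₁ B)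
  d≡0-within A B s |A|≡s |B|≡s =
    subst (λ x → (x ≡ 0) ⇔ (proj₁ A ≡ proj₁ B)) (sym (d-within A B s |A|≡s |B|≡s))
      (full-overlap⇔ ⇔-∘ (∸≡0⇔≤ s (ι A B) ⇔-∘ (⌈⌉≡0⇔ m (s ∸ ι A B) ⇔-∘ even≡0⇔ (ceil (s ∸ ι A B)))))
    where
    full-overlap⇔ : (s ≤ ι A B) ⇔ (proj₁ A ≡ proj₁ B)
    full-overlap⇔ = subst (λ t → (t ≤ ι A B) ⇔ (proj₁ A ≡ proj₁ B)) |A|≡s
      (≡⇔full-overlap (proj₁ A) (proj₁ B) (trans |A|≡s (sym |B|≡s)))

  -- Across layers d is odd, and the sets differ.
  d≡0-across : ∀ A B → ∣ proj₁ A ∣ ≢ ∣ proj₁ B ∣ → (D A B ≡ 0) ⇔ (proj₁ A ≡ proj₁ B)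
  d≡0-across A B |A|≢|B| = mk⇔
    (λ D≡0 → ⊥-elim (odd≢0 (ceil (k ∸ ι A B)) (trans (sym (d-across A B |A|≢|B|)) D≡0)))
    (λ A≡B → ⊥-elim (|A|≢|B| (cong ∣_∣ A≡B)))

  d≡0⇔ : ∀ A B → (D A B ≡ 0) ⇔ (proj₁ A ≡ proj₁ B)
  d≡0⇔ A@(_ , inj₁ |A|≡k) B@(_ , inj₁ |B|≡k) = d≡0-within A B k |A|≡k |B|≡k
  d≡0⇔ A@(_ , inj₂ |A|≡n∸k) B@(_ , inj₂ |B|≡n∸k) = d≡0-within A B (n ∸ k) |A|≡n∸k |B|≡n∸k
  d≡0⇔ A@(_ , inj₁ |A|≡k) B@(_ , inj₂ |B|≡n∸k) = d≡0-across A B (sizes-differ |A|≡k |B|≡n∸k)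
  d≡0⇔ A@(_ , inj₂ |A|≡n∸k) B@(_ , inj₁ |B|≡k) =
    d≡0-across A B (λ |A|≡|B| → sizes-differ |B|≡k |A|≡n∸k (sym |A|≡|B|))

  edge⇒sizes-differ : ∀ A B → Edge n k A B → ∣ proj₁ A ∣ ≢ ∣ proj₁ B ∣
  edge⇒sizes-differ A B (inj₁ (|A|≡k , |B|≡n∸k , _)) = sizes-differ |A|≡k |B|≡n∸k
  edge⇒sizes-differ A B (inj₂ (|B|≡k , |A|≡n∸k , _)) |A|≡|B| = sizes-differ |B|≡k |A|≡n∸k (sym |A|≡|B|)

  -- On one layer d is even, and there are no edges.
  d≡1-within : ∀ A B s → ∣ proj₁ A ∣ ≡ s → ∣ proj₁ B ∣ ≡ s → (D A B ≡ 1) ⇔ Edge n k A B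
  d≡1-within A B s |A|≡s |B|≡s = mk⇔
    (λ D≡1 → ⊥-elim (even≢1 (ceil (s ∸ ι A B)) (trans (sym (d-within A B s |A|≡s |B|≡s)) D≡1)))
    (λ edge → ⊥-elim (edge⇒sizes-differ A B edge (trans |A|≡s (sym |B|≡s))))

  -- From a k-set A to an (n-k)-set B, d = 1 iff the defect k - |A∩B| vanishes, i.e. iff A ⊆ B.
  d≡1-upward : ∀ A B → ∣ proj₁ A ∣ ≡ k → ∣ proj₁ B ∣ ≡ n ∸ k → (D A B ≡ 1) ⇔ Edge n k A B
  d≡1-upward A B |A|≡k |B|≡n∸k =
    subst (λ x → (x ≡ 1) ⇔ Edge n k A B) (sym (d-across A B (sizes-differ |A|≡k |B|≡n∸k)))
      (⊆⇔edge ⇔-∘ (inclusion⇔ ⇔-∘ (∸≡0⇔≤ k (ι A B) ⇔-∘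
        (⌈⌉≡0⇔ m (k ∸ ι A B) ⇔-∘ odd≡1⇔ (ceil (k ∸ ι A B))))))
    where
    inclusion⇔ : (k ≤ ι A B) ⇔ (proj₁ A ⊆ proj₁ B)
    inclusion⇔ = subst (λ t → (t ≤ ι A B) ⇔ (proj₁ A ⊆ proj₁ B)) |A|≡k (⊆⇔full-overlap (proj₁ A) (proj₁ B))
    ⊆⇔edge : (proj₁ A ⊆ proj₁ B) ⇔ Edge n k A B
    ⊆⇔edge = mk⇔ (λ A⊆B → inj₁ (|A|≡k , |B|≡n∸k , A⊆B))
      (λ { (inj₁ (_ , _ , A⊆B)) → A⊆B
         ; (inj₂ (|B|≡k , _ , _)) → ⊥-elim (k≢n∸k (trans (sym |B|≡k) |B|≡n∸k)) })

  -- d(A,B) = 1 iff AB is an edge; the downward case follows from the upward one by symmetry.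
  d≡1⇔ : ∀ A B → (D A B ≡ 1) ⇔ Edge n k A B
  d≡1⇔ A@(_ , inj₁ |A|≡k) B@(_ , inj₁ |B|≡k) = d≡1-within A B k |A|≡k |B|≡k
  d≡1⇔ A@(_ , inj₂ |A|≡n∸k) B@(_ , inj₂ |B|≡n∸k) = d≡1-within A B (n ∸ k) |A|≡n∸k |B|≡n∸k
  d≡1⇔ A@(_ , inj₁ |A|≡k) B@(_ , inj₂ |B|≡n∸k) = d≡1-upward A B |A|≡k |B|≡n∸k
  d≡1⇔ A@(_ , inj₂ _) B@(_ , inj₁ _) =
    mk⇔ swap swap ⇔-∘ (d≡1⇔ B A ⇔-∘ mk⇔ (trans (d-sym B A)) (trans (d-sym A B)))

mainTheorem3 : (n k : ℕ) → (h : k < n ∸ k) → (A B C : Vertex n k) →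
    ((d n k h A B ≡ 0) ⇔ (proj₁ A ≡ proj₁ B))
    × (d n k h A B ≡ d n k h B A)
    × (d n k h A B + d n k h B C ≥ d n k h A C)
    × ((d n k h A B ≡ 1) ⇔ Edge n k A B)
mainTheorem3 n k h A B C = d≡0⇔ A B , d-sym A B , d-triangle A B C , d≡1⇔ A B
  where open Distance n k h
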